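{- Let $r$ and $s$ be positive integers, both odd. Then for every positive integer $n$ there exists a permutation of $1,\dots,n$ that avoids $(r,s)$ $3$-progressions.
   Context: An $(r,s)$ $3$-progression is a sequence $a, a+rd, a+rd+sd$ of integers with $d\neq 0$. A permutation $p_1,\dots,p_n$ contains one if there are indices $i_1<i_2<i_3$ such that $p_{i_1},p_{i_2},p_{i_3}$ is an $(r,s)$ $3$-progression. It avoids $(r,s)$ $3$-progressions otherwise. -}

module Defs where

open import Data.Nat using (ℕ; suc)
open import Data.Integer using (ℤ; +_; _+_; _*_; 0ℤ)
open import Data.Fin using (Fin; toℕ; _<_)
open import Data.Fin.Permutation using (Permutation′; _⟨$⟩ʳ_)
open import Data.Product using (Σ; _×_; ∃)
open import Relation.Nullary using (¬_)
open import Relation.Binary.PropositionalEquality using (_≡_)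

IsProgression : ℤ → ℤ → ℤ → ℤ → ℤ → Set
IsProgression r s x y z =
  Σ ℤ λ d → ¬ (d ≡ 0ℤ) × (y ≡ x + r * d) × (z ≡ x + r * d + s * d)

-- The value p_i (in 1..n) of a permutation of 1..n, represented as a
-- bijection of Fin n, at position i (positions 0..n-1).
val : {n : ℕ} → Permutation′ n → Fin n → ℤ
val π i = + suc (toℕ (π ⟨$⟩ʳ i))

Contains : ℤ → ℤ → {n : ℕ} → Permutation′ n → Set
Contains r s {n} π =
  Σ (Fin n) λ i₁ → Σ (Fin n) λ i₂ → Σ (Fin n) λ i₃ →
    (i₁ < i₂) × (i₂ < i₃) × IsProgression r s (val π i₁) (val π i₂) (val π i₃)

Avoids : ℤ → ℤ → {n : ℕ} → Permutation′ n → Set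
Avoids r s π = ¬ Contains r s π

module Submission where

-- Odd–even construction of permutations avoiding (r,s) 3-progressions for
-- odd r = 1 + 2r′ and s = 1 + 2s′.
--   * Parity: an (r,s) progression x, y, z has z − x = (r + s) d, which is
--     even, so it cannot start at an odd value and end at an even one.
--   * Halving: if c + 2A, c + 2B, c + 2C is an (r,s) progression with step d,
--     then r d = 2 (B − A) forces d to be even because r is odd, and A, B, C
--     is an (r,s) progression with step d / 2.
-- Given avoiding permutations α of 1..⌈n/2⌉ and β of 1..⌊n/2⌋, the block
-- permutation 2α − 1 followed by 2β (odd values in the first ⌈n/2⌉ positions,
-- even values after them) is again avoiding: a progression inside one block
-- halves to a progression in α or β, one from the odd into the even block
-- contradicts the parity fact, and all other patterns of blocks contradict
-- i₁ < i₂ < i₃.  Strong induction on n yields avoiding permutations of every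
-- length.

open import Defs
open import Data.Nat using (ℕ; _%_; _<_)
open import Data.Integer using (+_)
open import Data.Fin.Permutation using (Permutation′)
open import Data.Product using (Σ)
open import Relation.Binary.PropositionalEquality using (_≡_)

open import Algebra.Bundles using (AbelianGroup)
open import Data.Empty using (⊥)
open import Data.Fin using (Fin; zero; suc; toℕ; splitAt; cast)
open import Data.Fin.Permutation using (_⟨$⟩ʳ_; cast-id; id)
open import Data.Fin.Properties using (+↔⊎; toℕ-cast; toℕ<n; toℕ-↑ˡ; toℕ-↑ʳ; splitAt⁻¹-↑ˡ; splitAt⁻¹-↑ʳ)
open import Data.Integer using (ℤ; 0ℤ; -1ℤ; +[1+_]; ∣_∣; _+_; _-_; _*_)
open import Data.Integer.Properties using (pos-*; *-comm; *-cancelˡ-≡; +-0-abelianGroup)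
open import Data.Integer.Tactic.RingSolver using (solve-∀)
open import Data.Nat as ℕ using (⌈_/2⌉; ⌊_/2⌋)
open import Data.Nat.DivMod using (_/_; m≡m%n+[m/n]*n)
open import Data.Nat.Induction using (<-rec)
open import Data.Nat.Properties as ℕₚ using (⌊n/2⌋+⌈n/2⌉≡n; ⌈n/2⌉<n; ⌊n/2⌋<n)
open import Data.Product using (_,_)
open import Data.Sum as Sum using (_⊎_; inj₁; inj₂)
open import Data.Sum.Function.Propositional using (_⊎-↔_)
open import Function.Bundles using (_↔_; mk↔ₛ′)
open import Function.Construct.Composition using (_↔-∘_)
open import Relation.Nullary using (¬_)
open import Relation.Binary.PropositionalEquality using (_≢_; refl; sym; trans; cong; subst₂; module ≡-Reasoning)

open import Algebra.Properties.Group (AbelianGroup.group +-0-abelianGroup) using (∙-cancelˡ)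

odd : ℤ → ℤ
odd k = + 1 + + 2 * k

odd-ℕ : ∀ m → m % 2 ≡ 1 → + m ≡ odd (+ (m / 2))
odd-ℕ m m%2≡1 = begin
  + m                ≡⟨ cong +_ (trans (m≡m%n+[m/n]*n m 2) (cong (ℕ._+ q ℕ.* 2) m%2≡1)) ⟩
  + 1 + + (q ℕ.* 2)  ≡⟨ cong (_+_ (+ 1)) (trans (pos-* q 2) (*-comm (+ q) (+ 2))) ⟩
  odd (+ q)          ∎
  where
  open ≡-Reasoning
  q = m / 2

even≢odd : ∀ w v → + 2 * w ≢ odd v
even≢odd w v 2w≡odd = twice≢1 (w - v) (begin
  + 2 * (w - v)          ≡⟨ distrib w v ⟩
  + 2 * w - + 2 * v      ≡⟨ cong (_- + 2 * v) 2w≡odd ⟩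
  odd v - + 2 * v        ≡⟨ cancel v ⟩
  + 1                    ∎)
  where
  open ≡-Reasoning
  distrib : ∀ w v → + 2 * (w - v) ≡ + 2 * w - + 2 * v
  distrib = solve-∀
  cancel : ∀ v → + 1 + + 2 * v - + 2 * v ≡ + 1
  cancel = solve-∀
  twice≢1 : ∀ u → + 2 * u ≢ + 1
  twice≢1 +[1+ k ] eq = ℕₚ.m+1+n≢0 k (ℕₚ.suc-injective (cong ∣_∣ (trans (pos-* 2 (ℕ.suc k)) eq)))

odd-times-even : ∀ r′ d m → odd r′ * d ≡ + 2 * m → d ≡ + 2 * (m - r′ * d)
odd-times-even r′ d m rd≡2m = begin
  d                            ≡⟨ split-off r′ d ⟩
  odd r′ * d - + 2 * (r′ * d)  ≡⟨ cong (_- + 2 * (r′ * d)) rd≡2m ⟩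
  + 2 * m - + 2 * (r′ * d)     ≡⟨ factor m (r′ * d) ⟩
  + 2 * (m - r′ * d)           ∎
  where
  open ≡-Reasoning
  split-off : ∀ r′ d → d ≡ (+ 1 + + 2 * r′) * d - + 2 * (r′ * d)
  split-off = solve-∀
  factor : ∀ m t → + 2 * m - + 2 * t ≡ + 2 * (m - t)
  factor = solve-∀

shift-double-injective : ∀ c u v → c + + 2 * u ≡ c + + 2 * v → u ≡ v
shift-double-injective c u v eq = *-cancelˡ-≡ (+ 2) u v (∙-cancelˡ c (+ 2 * u) (+ 2 * v) eq)

progression-cong : ∀ r s {x y z x′ y′ z′} → x ≡ x′ → y ≡ y′ → z ≡ z′ →
  IsProgression r s x y z → IsProgression r s x′ y′ z′
progression-cong _ _ refl refl refl p = p

ends-differ-by-even : ∀ r′ s′ {x y z} → IsProgression (odd r′) (odd s′) x y z →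
  Σ ℤ λ w → z - x ≡ + 2 * w
ends-differ-by-even r′ s′ {x} {z = z} (d , _ , _ , z≡) = (+ 1 + r′ + s′) * d , (begin
  z - x                                  ≡⟨ cong (_- x) z≡ ⟩
  x + odd r′ * d + odd s′ * d - x        ≡⟨ collect x r′ s′ d ⟩
  + 2 * ((+ 1 + r′ + s′) * d)            ∎)
  where
  open ≡-Reasoning
  collect : ∀ x r′ s′ d →
    x + (+ 1 + + 2 * r′) * d + (+ 1 + + 2 * s′) * d - x ≡ + 2 * ((+ 1 + r′ + s′) * d)
  collect = solve-∀

no-odd-to-even-progression : ∀ r′ s′ A C {y} →
  ¬ IsProgression (odd r′) (odd s′) (-1ℤ + + 2 * A) y (0ℤ + + 2 * C)
no-odd-to-even-progression r′ s′ A C p with ends-differ-by-even r′ s′ p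
... | w , diff≡2w = even≢odd w (C - A) (trans (sym diff≡2w) (odd-difference A C))
  where
  odd-difference : ∀ A C → 0ℤ + + 2 * C - (-1ℤ + + 2 * A) ≡ + 1 + + 2 * (C - A)
  odd-difference = solve-∀

halve-progression : ∀ r′ s c A B C →
  IsProgression (odd r′) s (c + + 2 * A) (c + + 2 * B) (c + + 2 * C) →
  IsProgression (odd r′) s A B C
halve-progression r′ s c A B C (d , d≢0 , B≡ , C≡) = e , e≢0 , B≡A+re , C≡A+re+se
  where
  open ≡-Reasoning
  r = odd r′
  e = B - A - r′ * d
  difference : ∀ p q → q ≡ p + q - p
  difference = solve-∀
  shift-cancel : ∀ c A B → c + + 2 * B - (c + + 2 * A) ≡ + 2 * (B - A)
  shift-cancel = solve-∀
  collect₁ : ∀ c A r e → c + + 2 * A + r * (+ 2 * e) ≡ c + + 2 * (A + r * e)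
  collect₁ = solve-∀
  collect₂ : ∀ c A r s e →
    c + + 2 * A + r * (+ 2 * e) + s * (+ 2 * e) ≡ c + + 2 * (A + r * e + s * e)
  collect₂ = solve-∀
  rd≡2[B-A] : r * d ≡ + 2 * (B - A)
  rd≡2[B-A] = begin
    r * d                                   ≡⟨ difference (c + + 2 * A) (r * d) ⟩
    c + + 2 * A + r * d - (c + + 2 * A)     ≡⟨ cong (_- (c + + 2 * A)) (sym B≡) ⟩
    c + + 2 * B - (c + + 2 * A)             ≡⟨ shift-cancel c A B ⟩
    + 2 * (B - A)                           ∎
  d≡2e : d ≡ + 2 * e
  d≡2e = odd-times-even r′ d (B - A) rd≡2[B-A]
  e≢0 : ¬ (e ≡ 0ℤ)
  e≢0 e≡0 = d≢0 (trans d≡2e (cong (+ 2 *_) e≡0))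
  B≡A+re : B ≡ A + r * e
  B≡A+re = shift-double-injective c B (A + r * e) (begin
    c + + 2 * B                       ≡⟨ B≡ ⟩
    c + + 2 * A + r * d               ≡⟨ cong (λ t → c + + 2 * A + r * t) d≡2e ⟩
    c + + 2 * A + r * (+ 2 * e)       ≡⟨ collect₁ c A r e ⟩
    c + + 2 * (A + r * e)             ∎)
  C≡A+re+se : C ≡ A + r * e + s * e
  C≡A+re+se = shift-double-injective c C (A + r * e + s * e) (begin
    c + + 2 * C                                   ≡⟨ C≡ ⟩
    c + + 2 * A + r * d + s * d                   ≡⟨ cong (λ t → c + + 2 * A + r * t + s * t) d≡2e ⟩
    c + + 2 * A + r * (+ 2 * e) + s * (+ 2 * e)   ≡⟨ collect₂ c A r s e ⟩
    c + + 2 * (A + r * e + s * e)                 ∎)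

-- The elements of Fin n split into the even ones 2x (x < ⌈n/2⌉) and the odd
-- ones 2y + 1 (y < ⌊n/2⌋); merge and split are mutually inverse.
merge : ∀ {n} → Fin ⌈ n /2⌉ ⊎ Fin ⌊ n /2⌋ → Fin n
merge {ℕ.suc n}           (inj₁ zero)    = zero
merge {ℕ.suc (ℕ.suc n)}   (inj₁ (suc x)) = suc (suc (merge (inj₁ x)))
merge {ℕ.suc (ℕ.suc n)}   (inj₂ zero)    = suc zero
merge {ℕ.suc (ℕ.suc n)}   (inj₂ (suc y)) = suc (suc (merge (inj₂ y)))

split : ∀ {n} → Fin n → Fin ⌈ n /2⌉ ⊎ Fin ⌊ n /2⌋
split {ℕ.suc ℕ.zero}      zero          = inj₁ zero
split {ℕ.suc (ℕ.suc n)}   zero          = inj₁ zero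
split {ℕ.suc (ℕ.suc n)}   (suc zero)    = inj₂ zero
split {ℕ.suc (ℕ.suc n)}   (suc (suc k)) = Sum.map suc suc (split k)

merge-split : ∀ {n} (k : Fin n) → merge (split k) ≡ k
merge-split {ℕ.suc ℕ.zero}    zero       = refl
merge-split {ℕ.suc (ℕ.suc n)} zero       = refl
merge-split {ℕ.suc (ℕ.suc n)} (suc zero) = refl
merge-split {ℕ.suc (ℕ.suc n)} (suc (suc k)) with split k | merge-split k
... | inj₁ x | merge-x≡k = cong (λ j → suc (suc j)) merge-x≡k
... | inj₂ y | merge-y≡k = cong (λ j → suc (suc j)) merge-y≡k

split-merge : ∀ {n} (t : Fin ⌈ n /2⌉ ⊎ Fin ⌊ n /2⌋) → split {n} (merge t) ≡ t
split-merge {ℕ.suc ℕ.zero}    (inj₁ zero)    = refl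
split-merge {ℕ.suc (ℕ.suc n)} (inj₁ zero)    = refl
split-merge {ℕ.suc (ℕ.suc n)} (inj₁ (suc x)) = cong (Sum.map suc suc) (split-merge {n} (inj₁ x))
split-merge {ℕ.suc (ℕ.suc n)} (inj₂ zero)    = refl
split-merge {ℕ.suc (ℕ.suc n)} (inj₂ (suc y)) = cong (Sum.map suc suc) (split-merge {n} (inj₂ y))

toℕ-merge-even : ∀ {n} (x : Fin ⌈ n /2⌉) → toℕ (merge {n} (inj₁ x)) ≡ toℕ x ℕ.+ toℕ x
toℕ-merge-even {ℕ.suc n}         zero    = refl
toℕ-merge-even {ℕ.suc (ℕ.suc n)} (suc x) =
  cong ℕ.suc (trans (cong ℕ.suc (toℕ-merge-even {n} x)) (sym (ℕₚ.+-suc (toℕ x) (toℕ x))))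

toℕ-merge-odd : ∀ {n} (y : Fin ⌊ n /2⌋) → toℕ (merge {n} (inj₂ y)) ≡ ℕ.suc (toℕ y ℕ.+ toℕ y)
toℕ-merge-odd {ℕ.suc (ℕ.suc n)} zero    = refl
toℕ-merge-odd {ℕ.suc (ℕ.suc n)} (suc y) =
  cong (λ m → ℕ.suc (ℕ.suc m)) (trans (toℕ-merge-odd {n} y) (sym (ℕₚ.+-suc (toℕ y) (toℕ y))))

interleave : ∀ {n} → (Fin ⌈ n /2⌉ ⊎ Fin ⌊ n /2⌋) ↔ Fin n
interleave = mk↔ₛ′ merge split merge-split split-merge

-- In the value convention val π i = 1 + π(i), the value 2k of Fin n is the
-- odd number −1 + 2(1 + k) and 2k + 1 is the even number 2(1 + k).
odd-value : ∀ k → + ℕ.suc (k ℕ.+ k) ≡ -1ℤ + + 2 * + ℕ.suc k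
odd-value k = rearrange (+ k)
  where
  rearrange : ∀ K → + 1 + (K + K) ≡ -1ℤ + + 2 * (+ 1 + K)
  rearrange = solve-∀

even-value : ∀ k → + ℕ.suc (ℕ.suc (k ℕ.+ k)) ≡ 0ℤ + + 2 * + ℕ.suc k
even-value k = rearrange (+ k)
  where
  rearrange : ∀ K → + 1 + (+ 1 + (K + K)) ≡ 0ℤ + + 2 * (+ 1 + K)
  rearrange = solve-∀

block-order : ∀ {a i j} (x : Fin a) (y : ℕ) → i ≡ toℕ x → j ≡ a ℕ.+ y → i < j
block-order {a} x y refl refl = ℕₚ.<-≤-trans (toℕ<n x) (ℕₚ.m≤m+n a y)

-- The block permutation of α and β: position i < ⌈n/2⌉ gets value 2α(i) − 1,
-- position ⌈n/2⌉ + j gets value 2β(j).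
module Blocks {n} (α : Permutation′ ⌈ n /2⌉) (β : Permutation′ ⌊ n /2⌋) where

  sizes : n ≡ ⌈ n /2⌉ ℕ.+ ⌊ n /2⌋
  sizes = trans (sym (⌊n/2⌋+⌈n/2⌉≡n n)) (ℕₚ.+-comm ⌊ n /2⌋ ⌈ n /2⌉)

  blocks : Permutation′ n
  blocks = interleave ↔-∘ ((α ⊎-↔ β) ↔-∘ (+↔⊎ ↔-∘ cast-id sizes))

  data Position (i : Fin n) : Set where
    odd-block  : (x : Fin ⌈ n /2⌉) → toℕ i ≡ toℕ x →
                 val blocks i ≡ -1ℤ + + 2 * val α x → Position i
    even-block : (y : Fin ⌊ n /2⌋) → toℕ i ≡ ⌈ n /2⌉ ℕ.+ toℕ y →
                 val blocks i ≡ 0ℤ + + 2 * val β y → Position i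

  value-at : Fin ⌈ n /2⌉ ⊎ Fin ⌊ n /2⌋ → ℤ
  value-at t = + ℕ.suc (toℕ (merge (Sum.map (α ⟨$⟩ʳ_) (β ⟨$⟩ʳ_) t)))

  position : ∀ i → Position i
  position i with splitAt ⌈ n /2⌉ (cast sizes i) in split≡
  ... | inj₁ x = odd-block x
    (trans (sym (toℕ-cast sizes i)) (trans (cong toℕ (sym (splitAt⁻¹-↑ˡ split≡))) (toℕ-↑ˡ x _)))
    (trans (cong value-at split≡)
      (trans (cong (λ m → + ℕ.suc m) (toℕ-merge-even (α ⟨$⟩ʳ x))) (odd-value (toℕ (α ⟨$⟩ʳ x)))))
  ... | inj₂ y = even-block y
    (trans (sym (toℕ-cast sizes i)) (trans (cong toℕ (sym (splitAt⁻¹-↑ʳ split≡))) (toℕ-↑ʳ _ y)))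
    (trans (cong value-at split≡)
      (trans (cong (λ m → + ℕ.suc m) (toℕ-merge-odd {n} (β ⟨$⟩ʳ y))) (even-value (toℕ (β ⟨$⟩ʳ y)))))

  blocks-avoid : ∀ r′ s′ → Avoids (odd r′) (odd s′) α → Avoids (odd r′) (odd s′) β →
    Avoids (odd r′) (odd s′) blocks
  blocks-avoid r′ s′ α-avoids β-avoids (i₁ , i₂ , i₃ , i₁<i₂ , i₂<i₃ , prog) =
    by-blocks (position i₁) (position i₂) (position i₃)
    where
    -- Three positions in one block halve to a progression in α or β; odd to
    -- even contradicts parity; an even position before an odd one contradicts
    -- the block order.
    by-blocks : Position i₁ → Position i₂ → Position i₃ → ⊥
    by-blocks (odd-block x₁ p₁ v₁) (odd-block x₂ p₂ v₂) (odd-block x₃ p₃ v₃) =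
      α-avoids (x₁ , x₂ , x₃ , subst₂ _<_ p₁ p₂ i₁<i₂ , subst₂ _<_ p₂ p₃ i₂<i₃ ,
                halve-progression r′ (odd s′) -1ℤ (val α x₁) (val α x₂) (val α x₃)
                  (progression-cong (odd r′) (odd s′) v₁ v₂ v₃ prog))
    by-blocks (even-block y₁ p₁ v₁) (even-block y₂ p₂ v₂) (even-block y₃ p₃ v₃) =
      β-avoids (y₁ , y₂ , y₃ ,
                ℕₚ.+-cancelˡ-< ⌈ n /2⌉ _ _ (subst₂ _<_ p₁ p₂ i₁<i₂) ,
                ℕₚ.+-cancelˡ-< ⌈ n /2⌉ _ _ (subst₂ _<_ p₂ p₃ i₂<i₃) ,
                halve-progression r′ (odd s′) 0ℤ (val β y₁) (val β y₂) (val β y₃)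
                  (progression-cong (odd r′) (odd s′) v₁ v₂ v₃ prog))
    by-blocks (odd-block x₁ _ v₁) _ (even-block y₃ _ v₃) =
      no-odd-to-even-progression r′ s′ (val α x₁) (val β y₃)
        (progression-cong (odd r′) (odd s′) v₁ refl v₃ prog)
    by-blocks (even-block y₁ p₁ _) (odd-block x₂ p₂ _) _ =
      ℕₚ.<-asym i₁<i₂ (block-order x₂ (toℕ y₁) p₂ p₁)
    by-blocks _ (even-block y₂ p₂ _) (odd-block x₃ p₃ _) =
      ℕₚ.<-asym i₂<i₃ (block-order x₃ (toℕ y₂) p₃ p₂)

open Blocks using (blocks; blocks-avoid)

avoiding : ∀ r′ s′ n → Σ (Permutation′ n) λ π → Avoids (odd r′) (odd s′) π
avoiding r′ s′ = <-rec Avoiding step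
  where
  Avoiding : ℕ → Set
  Avoiding n = Σ (Permutation′ n) λ π → Avoids (odd r′) (odd s′) π
  step : ∀ n → (∀ {m} → m < n → Avoiding m) → Avoiding n
  step ℕ.zero _ = id , λ { (() , _) }
  step (ℕ.suc ℕ.zero) _ = id , λ { (zero , zero , _ , () , _) }
  step n@(ℕ.suc (ℕ.suc m)) smaller with smaller (⌈n/2⌉<n m) | smaller (⌊n/2⌋<n (ℕ.suc m))
  ... | α , α-avoids | β , β-avoids = blocks α β , blocks-avoid α β r′ s′ α-avoids β-avoids

mainTheorem8 : (r s : ℕ) → 0 < r → 0 < s → r % 2 ≡ 1 → s % 2 ≡ 1 →
    (n : ℕ) → 0 < n → Σ (Permutation′ n) λ π → Avoids (+ r) (+ s) π
mainTheorem8 r s _ _ r-odd s-odd n _ =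
  subst₂ (λ r s → Σ (Permutation′ n) λ π → Avoids r s π)
    (sym (odd-ℕ r r-odd)) (sym (odd-ℕ s s-odd))
    (avoiding (+ (r / 2)) (+ (s / 2)) n)
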